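{- The polynomials that are both fundamental particles and Young fundamental particles are precisely the $\hat{\mathfrak L}_a$ such that $a$ has no zero part adjacent to a part of size at least $2$.
   Context: Weak compositions have length $n$. The fundamental particle $\mathfrak L_a$ is the generating function of fillings of the diagram of $a$ (row $i$ has $a_i$ left-justified boxes) such that rows weakly decrease left to right, the first entry of each row $i$ equals $i$, and whenever $i<j$ every entry of row $i$ is strictly smaller than every entry of row $j$. The Young fundamental particle is $\hat{\mathfrak L}_a(x_1,\ldots,x_n)=\mathfrak L_{\mathrm{rev}(a)}(x_n,\ldots,x_1)$ (equivalently generated by the analogous fillings with rows weakly increasing), where $\mathrm{rev}(a)$ is $a$ reversed. -}

module Defs where

open import Data.Nat using (ℕ; zero; suc; _+_; _<_)
import Data.Nat as ℕ
open import Data.Bool using (Bool; true; false; _∧_; if_then_else_)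
open import Data.Fin using (Fin; toℕ)
import Data.Fin as F
open import Data.List using (List; []; _∷_; map; filterᵇ; allFin; concatMap; length)
open import Data.Bool.ListAction using (and)
open import Data.Nat.ListAction using (sum)
open import Data.Vec using (Vec; []; _∷_; lookup; tabulate; reverse)
open import Data.Vec.Properties using (≡-dec)
open import Data.Product using (_×_)
open import Relation.Nullary.Decidable using (⌊_⌋)
open import Relation.Binary.PropositionalEquality using (_≡_)

-- Variables x_1..x_n and rows 1..n are indexed by Fin n (0-based shift).
-- A monomial x^α is represented by its exponent vector α : Vec ℕ n;
-- a polynomial by its coefficient function  Vec ℕ n → ℕ.

Poly : ℕ → Set
Poly n = Vec ℕ n → ℕ

words : (n m : ℕ) → List (List (Fin n))
words n zero    = [] ∷ []
words n (suc m) = concatMap (λ x → map (x ∷_) (words n m)) (allFin n)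

-- all assignments of entries to the boxes of the diagram of a
-- (row i gets a list of length a_i)
assignments : ∀ {n k} → Vec ℕ k → List (Vec (List (Fin n)) k)
assignments []       = [] ∷ []
assignments {n} (m ∷ a) =
  concatMap (λ r → map (r ∷_) (assignments a)) (words n m)

weaklyDecr : ∀ {n} → List (Fin n) → Bool
weaklyDecr []           = true
weaklyDecr (x ∷ [])     = true
weaklyDecr (x ∷ y ∷ r)  = ⌊ y F.≤? x ⌋ ∧ weaklyDecr (y ∷ r)

firstIs : ∀ {n} → Fin n → List (Fin n) → Bool
firstIs i []      = true
firstIs i (x ∷ _) = ⌊ x F.≟ i ⌋

allLess : ∀ {n} → List (Fin n) → List (Fin n) → Bool
allLess r s = and (map (λ x → and (map (λ y → ⌊ x F.<? y ⌋) s)) r)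

validFilling : ∀ {n} → Vec (List (Fin n)) n → Bool
validFilling {n} T =
  and (map (λ i → weaklyDecr (lookup T i) ∧ firstIs i (lookup T i)) (allFin n))
  ∧ and (map (λ i → and (map (λ j →
        if ⌊ i F.<? j ⌋ then allLess (lookup T i) (lookup T j) else true)
        (allFin n))) (allFin n))

countEq : ∀ {n} → Fin n → List (Fin n) → ℕ
countEq k r = length (filterᵇ (λ x → ⌊ x F.≟ k ⌋) r)

content : ∀ {n} → Vec (List (Fin n)) n → Vec ℕ n
content {n} T = tabulate (λ k → sum (map (λ i → countEq k (lookup T i)) (allFin n)))

-- coefficient of x^α in a multiset of monomials
coeff : ∀ {n} → List (Vec ℕ n) → Vec ℕ n → ℕ
coeff ms α = length (filterᵇ (λ β → ⌊ ≡-dec ℕ._≟_ β α ⌋) ms)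

𝔏 : ∀ {n} → Vec ℕ n → Poly n
𝔏 a = coeff (map content (filterᵇ validFilling (assignments a)))

-- Young fundamental particle: 𝔏̂_a(x_1..x_n) = 𝔏_{rev a}(x_n..x_1);
-- the substitution sends x^β to x^{rev β}, so [x^α] 𝔏̂_a = [x^{rev α}] 𝔏_{rev a}
𝔏̂ : ∀ {n} → Vec ℕ n → Poly n
𝔏̂ a α = 𝔏 (reverse a) (reverse α)

_≈P_ : ∀ {n} → Poly n → Poly n → Set
P ≈P Q = ∀ α → P α ≡ Q α

NoZeroAdjBig : ∀ {n} → Vec ℕ n → Set
NoZeroAdjBig {n} a = (i j : Fin n) → toℕ j ≡ suc (toℕ i) →
  (lookup a i ≡ 0 → lookup a j < 2) × (lookup a j ≡ 0 → lookup a i < 2)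

-- In a filling every nonempty row i starts with i, and an entry i
-- lies in no other row once row i is nonempty; so the weight is positive wherever s is, and
-- equals s as soon as its support is no larger. If 𝔏 b = 𝔏̂ a, the weights x^b and x^a of the
-- canonical fillings (row i filled with i) therefore force a = b.
-- If a_i = 0 and a_{i+1} ≥ 2, rewriting row i+1 as i+1, i, …, i gives a monomial x^β of 𝔏 a
-- with weight on the empty row i. A filling of shape rev a and weight rev β must take that
-- weight from a later row, which then falls short of its size, although β agrees with a on all
-- those rows. Reversal turns the case a_{i+1} = 0, a_i ≥ 2 into this one. Conversely, without
-- a zero part next to a part ≥ 2 the only fillings of shapes a and rev a are the canonical
-- ones, so 𝔏 a = x^a = 𝔏̂ a.

module Submission where

open import Data.Bool using (Bool; true; T; _∧_; if_then_else_)
open import Data.Bool.Properties using (T-∧)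
open import Data.Unit using (tt)
open import Data.Empty using (⊥-elim)
open import Data.Fin as F using (Fin; toℕ; opposite; inject₁; fromℕ)
import Data.Fin.Properties as FP
open import Data.List as L
  using (List; []; _∷_; _++_; map; filter; filterᵇ; length; replicate; allFin; concatMap; cartesianProductWith)
import Data.List.Properties as LP
open import Data.List.Membership.Propositional using (_∈_; _∉_; lose)
open import Data.List.Membership.Propositional.Properties
  using (∈-filter⁺; ∈-filter⁻; ∈-map⁺; ∈-map⁻; ∈-allFin; ∈-cartesianProductWith⁺; ∈-cartesianProductWith⁻)
open import Data.List.Relation.Unary.Any using (here; there)
import Data.List.Relation.Unary.All as All
open import Data.List.Relation.Unary.All.Properties
  using (all⁺; all⁻; tabulate⁺; tabulate⁻; replicate⁺)
open import Data.List.Relation.Unary.Unique.Propositional using (Unique; []; _∷_)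
open import Data.List.Relation.Unary.Unique.Propositional.Properties
  using (cartesianProductWith⁺; allFin⁺; filter⁺)
open import Data.Nat as ℕ using (ℕ; zero; suc; _+_; _∸_; _≤_; _<_; s≤s; z<s)
open import Data.Nat.ListAction using (sum)
open import Data.Nat.Properties
  using (≤-refl; ≤-trans; ≤-pred; <⇒≤; <-trans; <-irrefl; <-cmp; <⇒≱; ≰⇒>; ≤∧≢⇒<; m≤n⇒m<n∨m≡n;
         m≤m+n; m≤n+m; +-identityʳ; m+[n∸m]≡n; +-∸-assoc; ∸-monoʳ-<)
open import Data.Product using (_×_; _,_; proj₁; proj₂; ∃-syntax; Σ-syntax)
open import Data.Sum using (_⊎_; inj₁; inj₂)
open import Data.Vec as V using (Vec; lookup; reverse; _∷ʳ_; _[_]≔_)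
import Data.Vec.Properties as VP
open import Function using (_∘_; id)
open import Function.Bundles using (_⇔_; mk⇔; Equivalence)
open import Relation.Binary.PropositionalEquality
open import Relation.Nullary using (¬_; yes; no)
open import Relation.Nullary.Decidable using (⌊_⌋; toWitness; fromWitness; T?)
open import Relation.Unary using (Decidable)
open import Relation.Binary.Definitions using (tri<; tri≈; tri>)

open import Defs

concatMap-map≡cartesianProductWith : ∀ {A B C : Set} (f : A → B → C) xs ys →
  concatMap (λ x → map (f x) ys) xs ≡ cartesianProductWith f xs ys
concatMap-map≡cartesianProductWith f []       ys = refl
concatMap-map≡cartesianProductWith f (x ∷ xs) ys =
  cong (map (f x) ys ++_) (concatMap-map≡cartesianProductWith f xs ys)

unique-constant⇒singleton : ∀ {A : Set} {x : A} {xs} →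
  Unique xs → x ∈ xs → (∀ {y} → y ∈ xs → y ≡ x) → xs ≡ x ∷ []
unique-constant⇒singleton {xs = _ ∷ []} _ _ all≡x = cong (_∷ []) (all≡x (here refl))
unique-constant⇒singleton {xs = _ ∷ _ ∷ _} ((y≢z All.∷ _) ∷ _) _ all≡x =
  ⊥-elim (y≢z (trans (all≡x (here refl)) (sym (all≡x (there (here refl))))))

filter-nonempty⇒∃ : ∀ {A : Set} {P : A → Set} (P? : Decidable P) {xs} →
  0 < length (filter P? xs) → ∃[ x ] (x ∈ xs × P x)
filter-nonempty⇒∃ P? {xs} nonempty with filter P? xs in eq
... | y ∷ _ = y , ∈-filter⁻ P? (subst (y ∈_) (sym eq) (here refl))

∈-replicate⇒≡ : ∀ {A : Set} m {x y : A} → y ∈ replicate m x → y ≡ x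
∈-replicate⇒≡ m {x} = All.lookup (replicate⁺ {P = _≡ x} m refl)

constant⇒≡replicate : ∀ {A : Set} {x : A} (xs : List A) →
  (∀ {y} → y ∈ xs → y ≡ x) → xs ≡ replicate (length xs) x
constant⇒≡replicate []       _      = refl
constant⇒≡replicate (y ∷ xs) all≡x =
  cong₂ _∷_ (all≡x (here refl)) (constant⇒≡replicate xs (all≡x ∘ there))

length-pos⇒∃∈ : ∀ {A : Set} {xs : List A} → 0 < length xs → ∃[ x ] x ∈ xs
length-pos⇒∃∈ {xs = x ∷ _} _ = x , here refl

∈⇒length-pos : ∀ {A : Set} {x : A} {xs} → x ∈ xs → 0 < length xs
∈⇒length-pos (here _)  = z<s
∈⇒length-pos (there _) = z<s

sum-tabulate-zero : ∀ {n} (f : Fin n → ℕ) → (∀ i → f i ≡ 0) → sum (L.tabulate f) ≡ 0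
sum-tabulate-zero {zero}  f vanish = refl
sum-tabulate-zero {suc n} f vanish =
  cong₂ _+_ (vanish F.zero) (sum-tabulate-zero (f ∘ F.suc) (vanish ∘ F.suc))

sum-tabulate-single : ∀ {n} (f : Fin n → ℕ) k → (∀ i → i ≢ k → f i ≡ 0) → sum (L.tabulate f) ≡ f k
sum-tabulate-single f F.zero vanish =
  trans (cong (f F.zero +_) (sum-tabulate-zero (f ∘ F.suc) (λ i → vanish (F.suc i) λ ())))
        (+-identityʳ _)
sum-tabulate-single f (F.suc k) vanish =
  cong₂ _+_ (vanish F.zero λ ())
            (sum-tabulate-single (f ∘ F.suc) k λ i i≢k → vanish (F.suc i) (i≢k ∘ FP.suc-injective))

≤-sum-tabulate : ∀ {n} (f : Fin n → ℕ) i → f i ≤ sum (L.tabulate f)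
≤-sum-tabulate f F.zero    = m≤m+n _ _
≤-sum-tabulate f (F.suc i) = ≤-trans (≤-sum-tabulate (f ∘ F.suc) i) (m≤n+m _ (f F.zero))

sum-tabulate-pos⇒∃ : ∀ {n} (f : Fin n → ℕ) → 0 < sum (L.tabulate f) → ∃[ i ] 0 < f i
sum-tabulate-pos⇒∃ {suc n} f pos with f F.zero in eq
... | suc _ = F.zero , subst (0 <_) (sym eq) z<s
... | zero  = let i , fᵢ>0 = sum-tabulate-pos⇒∃ (f ∘ F.suc) pos in F.suc i , fᵢ>0

≗-lookup⇒≡ : ∀ {A : Set} {n} {u v : Vec A n} → (∀ i → lookup u i ≡ lookup v i) → u ≡ v
≗-lookup⇒≡ {u = u} {v} u≗v =
  trans (sym (VP.tabulate∘lookup u)) (trans (VP.tabulate-cong u≗v) (VP.tabulate∘lookup v))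

<⇒∃predecessor : ∀ {n} {x r : Fin n} → toℕ x < toℕ r → Σ[ i ∈ Fin n ] toℕ r ≡ suc (toℕ i)
<⇒∃predecessor {r = F.suc r} _ = inject₁ r , cong suc (sym (FP.toℕ-inject₁ r))

lookup-∷ʳ-fromℕ : ∀ {A : Set} {n} (xs : Vec A n) x → lookup (xs ∷ʳ x) (fromℕ n) ≡ x
lookup-∷ʳ-fromℕ V.[]       x = refl
lookup-∷ʳ-fromℕ (_ V.∷ xs) x = lookup-∷ʳ-fromℕ xs x

lookup-∷ʳ-inject₁ : ∀ {A : Set} {n} (xs : Vec A n) x i → lookup (xs ∷ʳ x) (inject₁ i) ≡ lookup xs i
lookup-∷ʳ-inject₁ (_ V.∷ xs) x F.zero    = refl
lookup-∷ʳ-inject₁ (_ V.∷ xs) x (F.suc i) = lookup-∷ʳ-inject₁ xs x i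

lookup-reverse : ∀ {A : Set} {n} (v : Vec A n) i → lookup (reverse v) (opposite i) ≡ lookup v i
lookup-reverse (x V.∷ xs) F.zero =
  trans (cong (λ w → lookup w (fromℕ _)) (VP.reverse-∷ x xs)) (lookup-∷ʳ-fromℕ (reverse xs) x)
lookup-reverse (x V.∷ xs) (F.suc i) =
  trans (cong (λ w → lookup w (inject₁ (opposite i))) (VP.reverse-∷ x xs))
        (trans (lookup-∷ʳ-inject₁ (reverse xs) x (opposite i)) (lookup-reverse xs i))

lookup-reverse′ : ∀ {A : Set} {n} (v : Vec A n) i → lookup (reverse v) i ≡ lookup v (opposite i)
lookup-reverse′ v i =
  trans (cong (lookup (reverse v)) (sym (FP.opposite-involutive i))) (lookup-reverse v (opposite i))

opposite-adjacent : ∀ {n} {i j : Fin n} →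
  toℕ j ≡ suc (toℕ i) → toℕ (opposite i) ≡ suc (toℕ (opposite j))
opposite-adjacent {n} {i} {j} j≡1+i = begin
  toℕ (opposite i)       ≡⟨ FP.opposite-prop i ⟩
  n ∸ suc (toℕ i)        ≡⟨ cong (n ∸_) (sym j≡1+i) ⟩
  suc n ∸ suc (toℕ j)    ≡⟨ +-∸-assoc 1 (FP.toℕ<n j) ⟩
  suc (n ∸ suc (toℕ j))  ≡⟨ cong suc (sym (FP.opposite-prop j)) ⟩
  suc (toℕ (opposite j)) ∎
  where open ≡-Reasoning

opposite-reverses-< : ∀ {n} {i j : Fin n} → toℕ i < toℕ j → toℕ (opposite j) < toℕ (opposite i)
opposite-reverses-< {n} {i} {j} i<j =
  subst₂ _<_ (sym (FP.opposite-prop j)) (sym (FP.opposite-prop i)) (∸-monoʳ-< (s≤s i<j) (FP.toℕ<n j))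

-- Fillings and their weights

Shape : ∀ {n k} → Vec ℕ k → Vec (List (Fin n)) k → Set
Shape s t = ∀ i → length (lookup t i) ≡ lookup s i

words-suc : ∀ n m → words n (suc m) ≡ cartesianProductWith _∷_ (allFin n) (words n m)
words-suc n m = concatMap-map≡cartesianProductWith _∷_ (allFin n) (words n m)

assignments-∷ : ∀ {n k} m (s : Vec ℕ k) →
  assignments {n} (m V.∷ s) ≡ cartesianProductWith V._∷_ (words n m) (assignments s)
assignments-∷ {n} m s = concatMap-map≡cartesianProductWith V._∷_ (words n m) (assignments s)

∈-words⁻ : ∀ {n} m {w : List (Fin n)} → w ∈ words n m → length w ≡ m
∈-words⁻ zero (here refl) = refl
∈-words⁻ {n} (suc m) w∈
  with ∈-cartesianProductWith⁻ _∷_ (allFin n) (words n m) (subst (_ ∈_) (words-suc n m) w∈)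
... | _ , _ , _ , w′∈ , refl = cong suc (∈-words⁻ m w′∈)

∈-words⁺ : ∀ {n} (w : List (Fin n)) → w ∈ words n (length w)
∈-words⁺ []      = here refl
∈-words⁺ {n} (x ∷ w) = subst (_ ∈_) (sym (words-suc n (length w)))
  (∈-cartesianProductWith⁺ _∷_ (∈-allFin x) (∈-words⁺ w))

words-unique : ∀ n m → Unique (words n m)
words-unique n zero    = All.[] ∷ []
words-unique n (suc m) = subst Unique (sym (words-suc n m))
  (cartesianProductWith⁺ _∷_ LP.∷-injective (allFin⁺ n) (words-unique n m))

∈-assignments⁻ : ∀ {n k} (s : Vec ℕ k) {t : Vec (List (Fin n)) k} → t ∈ assignments s → Shape s t
∈-assignments⁻ V.[] (here refl) ()
∈-assignments⁻ {n} (m V.∷ s) t∈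
  with ∈-cartesianProductWith⁻ V._∷_ (words n m) (assignments s) (subst (_ ∈_) (assignments-∷ m s) t∈)
... | _ , _ , w∈ , t′∈ , refl = λ where
  F.zero    → ∈-words⁻ m w∈
  (F.suc i) → ∈-assignments⁻ s t′∈ i

∈-assignments⁺ : ∀ {n k} (s : Vec ℕ k) (t : Vec (List (Fin n)) k) → Shape s t → t ∈ assignments s
∈-assignments⁺ V.[] V.[] _ = here refl
∈-assignments⁺ (m V.∷ s) (w V.∷ t) shape with shape F.zero
... | refl = subst (_ ∈_) (sym (assignments-∷ (length w) s))
  (∈-cartesianProductWith⁺ V._∷_ (∈-words⁺ w) (∈-assignments⁺ s t (shape ∘ F.suc)))

assignments-unique : ∀ {n k} (s : Vec ℕ k) → Unique (assignments {n} s)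
assignments-unique V.[]          = All.[] ∷ []
assignments-unique {n} (m V.∷ s) = subst Unique (sym (assignments-∷ m s))
  (cartesianProductWith⁺ V._∷_ VP.∷-injective (words-unique n m) (assignments-unique s))

module _ {n} (k : Fin n) where

  private
    is-k? : Decidable (λ (x : Fin n) → T ⌊ x F.≟ k ⌋)
    is-k? = T? ∘ (λ x → ⌊ x F.≟ k ⌋)

  ∈⇒countEq-pos : ∀ {r} → k ∈ r → 0 < countEq k r
  ∈⇒countEq-pos k∈r = LP.filter-some is-k? (lose k∈r (fromWitness refl))

  countEq-pos⇒∈ : ∀ {r} → 0 < countEq k r → k ∈ r
  countEq-pos⇒∈ pos with filter-nonempty⇒∃ is-k? pos
  ... | x , x∈r , x≟k = subst (_∈ _) (toWitness x≟k) x∈r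

  countEq≡0 : ∀ {r} → k ∉ r → countEq k r ≡ 0
  countEq≡0 k∉r = cong length (LP.filter-none is-k?
    (All.tabulate λ x∈r x≟k → k∉r (subst (_∈ _) (toWitness x≟k) x∈r)))

  countEq≡length : ∀ {r} → (∀ {x} → x ∈ r → x ≡ k) → countEq k r ≡ length r
  countEq≡length all≡k = cong length (LP.filter-all is-k? (All.tabulate (fromWitness ∘ all≡k)))

  countEq<length : ∀ {r x} → x ∈ r → x ≢ k → countEq k r < length r
  countEq<length x∈r x≢k = LP.filter-notAll is-k? _ (lose x∈r (x≢k ∘ toWitness))

Tableau : ℕ → Set
Tableau n = Vec (List (Fin n)) n

module _ {n} (t : Tableau n) where

  lookup-content : ∀ k → lookup (content t) k ≡ sum (L.tabulate (λ r → countEq k (lookup t r)))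
  lookup-content k =
    trans (VP.lookup∘tabulate _ k) (cong sum (LP.map-tabulate id (λ r → countEq k (lookup t r))))

  ∈⇒content-pos : ∀ {k r} → k ∈ lookup t r → 0 < lookup (content t) k
  ∈⇒content-pos {k} {r} k∈ = subst (0 <_) (sym (lookup-content k))
    (≤-trans (∈⇒countEq-pos k k∈) (≤-sum-tabulate _ r))

  content-pos⇒∈ : ∀ {k} → 0 < lookup (content t) k → ∃[ r ] k ∈ lookup t r
  content-pos⇒∈ {k} pos
    with r , pos′ ← sum-tabulate-pos⇒∃ _ (subst (0 <_) (lookup-content k) pos)
    = r , countEq-pos⇒∈ k pos′

  content-concentrated : ∀ {k} → (∀ r → r ≢ k → k ∉ lookup t r) →
    lookup (content t) k ≡ countEq k (lookup t k)
  content-concentrated {k} k∉ = trans (lookup-content k)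
    (sum-tabulate-single _ k (λ r r≢k → countEq≡0 k (k∉ r r≢k)))

  module _ {s : Vec ℕ n} (shape : Shape s t) (constant : ∀ {k x} → x ∈ lookup t k → x ≡ k) where

    rows-constant⇒content≡shape : content t ≡ s
    rows-constant⇒content≡shape = ≗-lookup⇒≡ λ k → begin
      lookup (content t) k    ≡⟨ content-concentrated (λ r r≢k k∈ → r≢k (sym (constant k∈))) ⟩
      countEq k (lookup t k)  ≡⟨ countEq≡length k constant ⟩
      length (lookup t k)     ≡⟨ shape k ⟩
      lookup s k              ∎
      where open ≡-Reasoning

RowsOK : ∀ {n} → Tableau n → Set
RowsOK t = ∀ i → T (weaklyDecr (lookup t i) ∧ firstIs i (lookup t i))

Separated : ∀ {n} → Tableau n → Set
Separated t = ∀ {i j x y} → toℕ i < toℕ j → x ∈ lookup t i → y ∈ lookup t j → toℕ x < toℕ y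

module _ {n} {r s : List (Fin n)} where

  allLess⇒ : T (allLess r s) → ∀ {x y} → x ∈ r → y ∈ s → toℕ x < toℕ y
  allLess⇒ r<s x∈r y∈s = toWitness (All.lookup (all⁺ _ s (All.lookup (all⁺ _ r r<s) x∈r)) y∈s)

  allLess⇐ : (∀ {x y} → x ∈ r → y ∈ s → toℕ x < toℕ y) → T (allLess r s)
  allLess⇐ r<s =
    all⁻ _ (All.tabulate λ x∈r → all⁻ _ (All.tabulate λ y∈s → fromWitness (r<s x∈r y∈s)))

validFilling⇔ : ∀ {n} (t : Tableau n) → T (validFilling t) ⇔ (RowsOK t × Separated t)
validFilling⇔ {n} t = mk⇔ to from
  where
  pairs : Fin n → Fin n → Bool
  pairs i j = if ⌊ i F.<? j ⌋ then allLess (lookup t i) (lookup t j) else true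

  pair⇒ : ∀ {i j} → toℕ i < toℕ j → T (pairs i j) → T (allLess (lookup t i) (lookup t j))
  pair⇒ {i} {j} i<j ok with i F.<? j
  ... | yes _   = ok
  ... | no i≮j = ⊥-elim (i≮j i<j)

  pair⇐ : Separated t → ∀ i j → T (pairs i j)
  pair⇐ separated i j with i F.<? j
  ... | yes i<j = allLess⇐ (separated i<j)
  ... | no _    = tt

  to : T (validFilling t) → RowsOK t × Separated t
  to valid = tabulate⁻ (all⁺ _ (allFin n) rows) , λ {i} {j} i<j → allLess⇒ (pair⇒ i<j
      (tabulate⁻ (all⁺ _ (allFin n) (tabulate⁻ (all⁺ _ (allFin n) separated) i)) j))
    where
    rows = proj₁ (Equivalence.to T-∧ valid)
    separated = proj₂ (Equivalence.to T-∧ valid)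

  from : RowsOK t × Separated t → T (validFilling t)
  from (rowsOK , separated) = Equivalence.from T-∧
    (all⁻ _ (tabulate⁺ rowsOK) , all⁻ _ (tabulate⁺ λ i → all⁻ _ (tabulate⁺ (pair⇐ separated i))))

record IsFilling {n} (s : Vec ℕ n) (t : Tableau n) : Set where
  field
    shape     : Shape s t
    rowsOK    : RowsOK t
    separated : Separated t

InSupport : ∀ {n} → Vec ℕ n → Vec ℕ n → Set
InSupport s α = ∃[ t ] (IsFilling s t × content t ≡ α)

valid⇒isFilling : ∀ {n} {s : Vec ℕ n} {t} → Shape s t → T (validFilling t) → IsFilling s t
valid⇒isFilling {t = t} shape valid =
  let rowsOK , separated = Equivalence.to (validFilling⇔ t) valid
  in record { shape = shape ; rowsOK = rowsOK ; separated = separated }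

isFilling⇒valid : ∀ {n} {s : Vec ℕ n} {t} → IsFilling s t → T (validFilling t)
isFilling⇒valid {t = t} F =
  Equivalence.from (validFilling⇔ t) (IsFilling.rowsOK F , IsFilling.separated F)

weaklyDecr-replicate : ∀ {n} m (x : Fin n) → T (weaklyDecr (replicate m x))
weaklyDecr-replicate zero          x = tt
weaklyDecr-replicate (suc zero)    x = tt
weaklyDecr-replicate (suc (suc m)) x =
  Equivalence.from T-∧ (fromWitness FP.≤-refl , weaklyDecr-replicate (suc m) x)

firstIs-replicate : ∀ {n} m (x : Fin n) → T (firstIs x (replicate m x))
firstIs-replicate zero    x = tt
firstIs-replicate (suc m) x = fromWitness refl

replicate-rowOK : ∀ {n} m (x : Fin n) → T (weaklyDecr (replicate m x) ∧ firstIs x (replicate m x))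
replicate-rowOK m x = Equivalence.from T-∧ (weaklyDecr-replicate m x , firstIs-replicate m x)

weaklyDecr⇒≤head : ∀ {n} {y : Fin n} {r x} → T (weaklyDecr (y ∷ r)) → x ∈ y ∷ r → toℕ x ≤ toℕ y
weaklyDecr⇒≤head _ (here refl) = ≤-refl
weaklyDecr⇒≤head {r = z ∷ r} decr (there x∈) =
  let z≤y , decr′ = Equivalence.to T-∧ decr in ≤-trans (weaklyDecr⇒≤head decr′ x∈) (toWitness z≤y)

canonical : ∀ {n} → Vec ℕ n → Tableau n
canonical s = V.tabulate (λ r → replicate (lookup s r) r)

module _ {n} (s : Vec ℕ n) where

  lookup-canonical : ∀ r → lookup (canonical s) r ≡ replicate (lookup s r) r
  lookup-canonical = VP.lookup∘tabulate _

  ∈-canonical⇒≡ : ∀ {r x} → x ∈ lookup (canonical s) r → x ≡ r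
  ∈-canonical⇒≡ {r} x∈ = ∈-replicate⇒≡ (lookup s r) (subst (_ ∈_) (lookup-canonical r) x∈)

  canonical-shape : Shape s (canonical s)
  canonical-shape r = trans (cong length (lookup-canonical r)) (LP.length-replicate (lookup s r))

  canonical-isFilling : IsFilling s (canonical s)
  canonical-isFilling = record
    { shape     = canonical-shape
    ; rowsOK    = λ r → subst (λ row → T (weaklyDecr row ∧ firstIs r row))
                    (sym (lookup-canonical r)) (replicate-rowOK (lookup s r) r)
    ; separated = λ i<j x∈ y∈ → subst₂ (λ x y → toℕ x < toℕ y)
                    (sym (∈-canonical⇒≡ x∈)) (sym (∈-canonical⇒≡ y∈)) i<j
    }

  content-canonical : content (canonical s) ≡ s
  content-canonical = rows-constant⇒content≡shape (canonical s) canonical-shape ∈-canonical⇒≡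

  canonical-inSupport : InSupport s s
  canonical-inSupport = canonical s , canonical-isFilling , content-canonical

module _ {n} {s : Vec ℕ n} {t : Tableau n} where

  rows-constant⇒≡canonical : Shape s t → (∀ {k x} → x ∈ lookup t k → x ≡ k) → t ≡ canonical s
  rows-constant⇒≡canonical shape constant = ≗-lookup⇒≡ λ k → begin
    lookup t k                                  ≡⟨ constant⇒≡replicate (lookup t k) constant ⟩
    replicate (length (lookup t k)) k           ≡⟨ cong (λ m → replicate m k) (shape k) ⟩
    replicate (lookup s k) k                    ≡⟨ sym (lookup-canonical s k) ⟩
    lookup (canonical s) k                      ∎
    where open ≡-Reasoning

LeftNice : ∀ {n} → Vec ℕ n → Set
LeftNice {n} s = (i j : Fin n) → toℕ j ≡ suc (toℕ i) → lookup s i ≡ 0 → lookup s j < 2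

module _ {n} {s : Vec ℕ n} {t : Tableau n} (F : IsFilling s t) where
  open IsFilling F

  row-structure : ∀ {i x} → x ∈ lookup t i →
    ∃[ rest ] (lookup t i ≡ i ∷ rest × T (weaklyDecr (i ∷ rest)))
  row-structure {i} x∈ with lookup t i | rowsOK i
  ... | y ∷ rest | ok with Equivalence.to T-∧ ok
  ...   | decr , y≟i with toWitness {a? = y F.≟ i} y≟i
  ...     | refl = rest , refl , decr

  entry≤row : ∀ {i x} → x ∈ lookup t i → toℕ x ≤ toℕ i
  entry≤row x∈ with row-structure x∈
  ... | _ , row≡ , decr = weaklyDecr⇒≤head decr (subst (_ ∈_) row≡ x∈)

  index∈row : ∀ {i} → 0 < lookup s i → i ∈ lookup t i
  index∈row {i} occupied
    with row-structure (proj₂ (length-pos⇒∃∈ (subst (0 <_) (sym (shape i)) occupied)))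
  ... | _ , row≡ , _ = subst (i ∈_) (sym row≡) (here refl)

  occupied-index∈row⇒≡ : ∀ {k r} → 0 < lookup s k → k ∈ lookup t r → r ≡ k
  occupied-index∈row⇒≡ {k} {r} occupied k∈ with <-cmp (toℕ r) (toℕ k)
  ... | tri< r<k _ _ = ⊥-elim (<⇒≱ r<k (entry≤row k∈))
  ... | tri≈ _ r≡k _ = FP.toℕ-injective r≡k
  ... | tri> _ _ k<r = ⊥-elim (<-irrefl refl (separated k<r (index∈row occupied) k∈))

  content-occupied : ∀ {k} → 0 < lookup s k → lookup (content t) k ≡ countEq k (lookup t k)
  content-occupied occupied =
    content-concentrated t (λ r r≢k k∈ → r≢k (occupied-index∈row⇒≡ occupied k∈))

  occupied⇒content-pos : ∀ {k} → 0 < lookup s k → 0 < lookup (content t) k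
  occupied⇒content-pos occupied = ∈⇒content-pos t (index∈row occupied)

  content≡shape : (∀ {k} → 0 < lookup (content t) k → 0 < lookup s k) → content t ≡ s
  content≡shape support⊆ = rows-constant⇒content≡shape t shape
    (λ x∈ → sym (occupied-index∈row⇒≡ (support⊆ (∈⇒content-pos t x∈)) x∈))

  content-deficit-above-empty-row : ∀ {m} → lookup s m ≡ 0 → 0 < lookup (content t) m →
    ∃[ r ] (toℕ m < toℕ r × lookup (content t) r < lookup s r)
  content-deficit-above-empty-row {m} empty pos with content-pos⇒∈ t pos
  ... | r , m∈ = r , m<r , deficit
    where
    occupied : 0 < lookup s r
    occupied = subst (0 <_) (shape r) (∈⇒length-pos m∈)
    m≢r : m ≢ r
    m≢r refl = <-irrefl (sym empty) occupied
    m<r : toℕ m < toℕ r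
    m<r = ≤∧≢⇒< (entry≤row m∈) (m≢r ∘ FP.toℕ-injective)
    deficit : lookup (content t) r < lookup s r
    deficit = subst₂ _<_ (sym (content-occupied occupied)) (shape r) (countEq<length r m∈ m≢r)

  entry<row⇒previous-row-empty : ∀ {k x} → x ∈ lookup t k → toℕ x < toℕ k →
    Σ[ i ∈ Fin n ] (toℕ k ≡ suc (toℕ i) × lookup s i ≡ 0)
  entry<row⇒previous-row-empty {k} {x} x∈ x<k with <⇒∃predecessor x<k
  ... | i , k≡1+i with lookup s i in sᵢ≡
  ...   | zero  = i , k≡1+i , sᵢ≡
  ...   | suc _ = ⊥-elim (<⇒≱ (separated i<k (index∈row (subst (0 <_) (sym sᵢ≡) z<s)) x∈) x≤i)
    where
    i<k : toℕ i < toℕ k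
    i<k = subst (toℕ i <_) (sym k≡1+i) ≤-refl
    x≤i : toℕ x ≤ toℕ i
    x≤i = ≤-pred (subst (toℕ x <_) k≡1+i x<k)

  leftNice⇒rows-constant : LeftNice s → ∀ {k x} → x ∈ lookup t k → x ≡ k
  leftNice⇒rows-constant nice {k} {x} x∈ with row-structure x∈
  ... | rest , row≡ , _ with subst (x ∈_) row≡ x∈
  ...   | here x≡k = x≡k
  ...   | there x∈rest with m≤n⇒m<n∨m≡n (entry≤row x∈)
  ...     | inj₂ x≡k = FP.toℕ-injective x≡k
  ...     | inj₁ x<k with entry<row⇒previous-row-empty x∈ x<k
  ...       | i , k≡1+i , sᵢ≡0 = ⊥-elim (<⇒≱ (nice i k k≡1+i sᵢ≡0) twice-occupied)
    where
    twice-occupied : 2 ≤ lookup s k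
    twice-occupied =
      subst (2 ≤_) (trans (cong length (sym row≡)) (shape k)) (s≤s (∈⇒length-pos x∈rest))

-- The support of a fundamental particle

module _ {n} (s α : Vec ℕ n) where

  private
    is-α? : Decidable (λ β → T ⌊ VP.≡-dec ℕ._≟_ β α ⌋)
    is-α? = T? ∘ (λ β → ⌊ VP.≡-dec ℕ._≟_ β α ⌋)

  inSupport⇒𝔏-pos : InSupport s α → 0 < 𝔏 s α
  inSupport⇒𝔏-pos (t , F , refl) = LP.filter-some is-α? (lose content∈ (fromWitness refl))
    where
    content∈ : content t ∈ map content (filterᵇ validFilling (assignments s))
    content∈ = ∈-map⁺ content (∈-filter⁺ (T? ∘ validFilling)
                 (∈-assignments⁺ s t (IsFilling.shape F)) (isFilling⇒valid F))

  𝔏-pos⇒inSupport : 0 < 𝔏 s α → InSupport s α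
  𝔏-pos⇒inSupport pos with filter-nonempty⇒∃ is-α? pos
  ... | β , β∈ , β≟α with ∈-map⁻ content β∈
  ...   | t , t∈ , refl with ∈-filter⁻ (T? ∘ validFilling) t∈
  ...     | t∈assignments , valid =
    t , valid⇒isFilling (∈-assignments⁻ s t∈assignments) valid , toWitness β≟α

inSupport-transfer : ∀ {n} (s α s′ α′ : Vec ℕ n) → 𝔏 s α ≡ 𝔏 s′ α′ → InSupport s α → InSupport s′ α′
inSupport-transfer s α s′ α′ eq = 𝔏-pos⇒inSupport s′ α′ ∘ subst (0 <_) eq ∘ inSupport⇒𝔏-pos s α

leftNice⇒valid-fillings≡canonical : ∀ {n} (s : Vec ℕ n) → LeftNice s →
  filterᵇ validFilling (assignments s) ≡ canonical s ∷ []
leftNice⇒valid-fillings≡canonical s nice = unique-constant⇒singleton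
  (filter⁺ (T? ∘ validFilling) (assignments-unique s))
  (∈-filter⁺ (T? ∘ validFilling) (∈-assignments⁺ s (canonical s) (canonical-shape s))
    (isFilling⇒valid (canonical-isFilling s)))
  ≡canonical
  where
  ≡canonical : ∀ {t} → t ∈ filterᵇ validFilling (assignments s) → t ≡ canonical s
  ≡canonical {t} t∈ with ∈-filter⁻ (T? ∘ validFilling) t∈
  ... | t∈assignments , valid =
    let F = valid⇒isFilling {s = s} {t} (∈-assignments⁻ s t∈assignments) valid
    in rows-constant⇒≡canonical {s = s} (IsFilling.shape F) (leftNice⇒rows-constant F nice)

𝔏-leftNice : ∀ {n} (s : Vec ℕ n) → LeftNice s → 𝔏 s ≈P coeff (s ∷ [])
𝔏-leftNice s nice α = begin
  coeff (map content (filterᵇ validFilling (assignments s))) α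
    ≡⟨ cong (λ ts → coeff (map content ts) α) (leftNice⇒valid-fillings≡canonical s nice) ⟩
  coeff (content (canonical s) ∷ []) α
    ≡⟨ cong (λ β → coeff (β ∷ []) α) (content-canonical s) ⟩
  coeff (s ∷ []) α
    ∎
  where open ≡-Reasoning

module _ {n} (s : Vec ℕ n) {i j : Fin n} (j≡1+i : toℕ j ≡ suc (toℕ i))
         (sᵢ≡0 : lookup s i ≡ 0) (sⱼ≥2 : 2 ≤ lookup s j) where

  shiftedRow : List (Fin n)
  shiftedRow = j ∷ i ∷ replicate (lookup s j ∸ 2) i

  shifted : Tableau n
  shifted = canonical s [ j ]≔ shiftedRow

  private
    i<j : toℕ i < toℕ j
    i<j = subst (toℕ i <_) (sym j≡1+i) ≤-refl

    lookup-shifted-j : lookup shifted j ≡ shiftedRow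
    lookup-shifted-j = VP.lookup∘update j (canonical s) shiftedRow

    lookup-shifted-other : ∀ {r} → r ≢ j → lookup shifted r ≡ replicate (lookup s r) r
    lookup-shifted-other {r} r≢j =
      trans (VP.lookup∘update′ r≢j (canonical s) shiftedRow) (lookup-canonical s r)

    ∈-shifted : ∀ {r x} → x ∈ lookup shifted r → x ≡ r ⊎ (r ≡ j × x ≡ i)
    ∈-shifted {r} x∈ with r F.≟ j
    ... | no r≢j = inj₁ (∈-replicate⇒≡ (lookup s r) (subst (_ ∈_) (lookup-shifted-other r≢j) x∈))
    ... | yes refl with subst (_ ∈_) lookup-shifted-j x∈
    ...   | here x≡j  = inj₁ x≡j
    ...   | there x∈′ = inj₂ (refl , ∈-replicate⇒≡ (suc (lookup s j ∸ 2)) x∈′)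

    shape : Shape s shifted
    shape r with r F.≟ j
    ... | no r≢j   =
      trans (cong length (lookup-shifted-other r≢j)) (LP.length-replicate (lookup s r))
    ... | yes refl =
      trans (cong length lookup-shifted-j)
            (trans (cong (2 +_) (LP.length-replicate (lookup s j ∸ 2))) (m+[n∸m]≡n sⱼ≥2))

    rowsOK : RowsOK shifted
    rowsOK r with r F.≟ j
    ... | no r≢j   = subst (λ row → T (weaklyDecr row ∧ firstIs r row))
                       (sym (lookup-shifted-other r≢j)) (replicate-rowOK (lookup s r) r)
    ... | yes refl = subst (λ row → T (weaklyDecr row ∧ firstIs j row))
                       (sym lookup-shifted-j) shiftedRow-ok
      where
      tail-decr : T (weaklyDecr (replicate (suc (lookup s j ∸ 2)) i))
      tail-decr = weaklyDecr-replicate (suc (lookup s j ∸ 2)) i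
      shiftedRow-ok : T (weaklyDecr shiftedRow ∧ firstIs j shiftedRow)
      shiftedRow-ok =
        Equivalence.from (T-∧ {⌊ i F.≤? j ⌋ ∧ weaklyDecr (replicate (suc (lookup s j ∸ 2)) i)})
          (Equivalence.from (T-∧ {⌊ i F.≤? j ⌋}) (fromWitness (<⇒≤ i<j) , tail-decr) , fromWitness refl)

    separated : Separated shifted
    separated {r} {r′} r<r′ x∈ y∈ with ∈-shifted x∈ | ∈-shifted y∈
    ... | inj₁ refl          | inj₁ refl          = r<r′
    ... | inj₂ (refl , refl) | inj₁ refl          = <-trans i<j r<r′
    ... | inj₂ (refl , _)    | inj₂ (refl , _)    = ⊥-elim (<-irrefl refl r<r′)
    ... | inj₁ refl          | inj₂ (refl , refl) = ≤∧≢⇒< r≤i r≢i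
      where
      r≤i : toℕ r ≤ toℕ i
      r≤i = ≤-pred (subst (toℕ r <_) j≡1+i r<r′)
      r≢i : toℕ r ≢ toℕ i
      r≢i r≡i = <-irrefl (sym sᵢ≡0) (subst (λ q → 0 < lookup s q) (FP.toℕ-injective r≡i)
                                       (subst (0 <_) (shape r) (∈⇒length-pos x∈)))

    content-other : ∀ {k} → k ≢ i → k ≢ j → lookup (content shifted) k ≡ lookup s k
    content-other {k} k≢i k≢j = begin
      lookup (content shifted) k           ≡⟨ content-concentrated shifted k∉other-rows ⟩
      countEq k (lookup shifted k)         ≡⟨ cong (countEq k) (lookup-shifted-other k≢j) ⟩
      countEq k (replicate (lookup s k) k) ≡⟨ countEq≡length k (∈-replicate⇒≡ (lookup s k)) ⟩
      length (replicate (lookup s k) k)    ≡⟨ LP.length-replicate (lookup s k) ⟩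
      lookup s k                           ∎
      where
      open ≡-Reasoning
      k∉other-rows : ∀ r → r ≢ k → k ∉ lookup shifted r
      k∉other-rows r r≢k k∈ with ∈-shifted k∈
      ... | inj₁ k≡r       = r≢k (sym k≡r)
      ... | inj₂ (_ , k≡i) = k≢i k≡i

  shift-into-empty-row :
    ∃[ β ] (InSupport s β × 0 < lookup β i × (∀ {k} → k ≢ i → k ≢ j → lookup β k ≡ lookup s k))
  shift-into-empty-row =
    content shifted ,
    (shifted , record { shape = shape ; rowsOK = rowsOK ; separated = separated } , refl) ,
    ∈⇒content-pos shifted (subst (i ∈_) (sym lookup-shifted-j) (there (here refl))) ,
    content-other

-- Fundamental particles that are Young fundamental particles

coeff-singleton-reverse : ∀ {n} (s α : Vec ℕ n) →
  coeff (reverse s ∷ []) (reverse α) ≡ coeff (s ∷ []) α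
coeff-singleton-reverse s α with VP.≡-dec ℕ._≟_ s α | VP.≡-dec ℕ._≟_ (reverse s) (reverse α)
... | yes _    | yes _  = refl
... | no _     | no _   = refl
... | yes refl | no s≢α = ⊥-elim (s≢α refl)
... | no s≢α   | yes eq = ⊥-elim (s≢α (VP.reverse-injective eq))

noZeroAdjBig⇔leftNice² : ∀ {n} (a : Vec ℕ n) → NoZeroAdjBig a ⇔ (LeftNice a × LeftNice (reverse a))
noZeroAdjBig⇔leftNice² a = mk⇔
  (λ nice → (λ i j adj → proj₁ (nice i j adj)) ,
            (λ i j adj aᵢ≡0 → subst (_< 2) (sym (lookup-reverse′ a j))
               (proj₂ (nice (opposite j) (opposite i) (opposite-adjacent adj))
                      (trans (sym (lookup-reverse′ a i)) aᵢ≡0))))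
  (λ (left , right) i j adj →
     left i j adj ,
     λ aⱼ≡0 → subst (_< 2) (lookup-reverse a i)
       (right (opposite j) (opposite i) (opposite-adjacent adj) (trans (lookup-reverse a j) aⱼ≡0)))

𝔏̂-leftNice : ∀ {n} (a : Vec ℕ n) → LeftNice (reverse a) → 𝔏̂ a ≈P coeff (a ∷ [])
𝔏̂-leftNice a nice α = trans (𝔏-leftNice (reverse a) nice (reverse α)) (coeff-singleton-reverse a α)

𝔏≈𝔏̂-reverse : ∀ {n} (a : Vec ℕ n) → 𝔏 a ≈P 𝔏̂ a → 𝔏 (reverse a) ≈P 𝔏̂ (reverse a)
𝔏≈𝔏̂-reverse a eq γ = begin
  𝔏 (reverse a) γ                      ≡⟨ cong (𝔏 (reverse a)) (sym (VP.reverse-involutive γ)) ⟩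
  𝔏 (reverse a) (reverse (reverse γ))  ≡⟨ sym (eq (reverse γ)) ⟩
  𝔏 a (reverse γ)                      ≡⟨ cong (λ v → 𝔏 v (reverse γ)) (sym (VP.reverse-involutive a)) ⟩
  𝔏 (reverse (reverse a)) (reverse γ)  ∎
  where open ≡-Reasoning

𝔏≈𝔏̂⇒≡ : ∀ {n} (b a : Vec ℕ n) → 𝔏 b ≈P 𝔏̂ a → b ≡ a
𝔏≈𝔏̂⇒≡ b a eq
  with inSupport-transfer (reverse a) (reverse a) b a (sym (eq a)) (canonical-inSupport (reverse a))
... | t , F , weight≡a = trans (sym (content≡shape F support⊆)) weight≡a
  where
  a⊆b : ∀ {k} → 0 < lookup a k → 0 < lookup b k
  a⊆b {k} pos with inSupport-transfer b b (reverse a) (reverse b) (eq b) (canonical-inSupport b)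
  ... | t′ , F′ , weight≡rev-b =
    subst (0 <_) (trans (cong (λ v → lookup v (opposite k)) weight≡rev-b) (lookup-reverse b k))
      (occupied⇒content-pos F′ (subst (0 <_) (sym (lookup-reverse a k)) pos))
  support⊆ : ∀ {k} → 0 < lookup (content t) k → 0 < lookup b k
  support⊆ {k} = a⊆b ∘ subst (λ v → 0 < lookup v k) weight≡a

𝔏≈𝔏̂⇒leftNice : ∀ {n} (a : Vec ℕ n) → 𝔏 a ≈P 𝔏̂ a → LeftNice a
𝔏≈𝔏̂⇒leftNice a eq i j j≡1+i aᵢ≡0 = ≰⇒> no-shift
  where
  no-shift : ¬ 2 ≤ lookup a j
  no-shift aⱼ≥2 with shift-into-empty-row a j≡1+i aᵢ≡0 aⱼ≥2
  ... | β , β∈supp , βᵢ>0 , β≡a-elsewhere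
    with inSupport-transfer a β (reverse a) (reverse β) (eq β) β∈supp
  ... | t , F , weight≡rev-β
    with content-deficit-above-empty-row F (trans (lookup-reverse a i) aᵢ≡0)
           (subst (0 <_) (sym (trans (cong (λ v → lookup v (opposite i)) weight≡rev-β) (lookup-reverse β i))) βᵢ>0)
  ... | r , opp-i<r , deficit = <-irrefl no-deficit deficit
    where
    opp-r<i : toℕ (opposite r) < toℕ i
    opp-r<i = subst (λ q → toℕ (opposite r) < toℕ q) (FP.opposite-involutive i) (opposite-reverses-< opp-i<r)
    opp-r≢i : opposite r ≢ i
    opp-r≢i e = <-irrefl (cong toℕ e) opp-r<i
    opp-r≢j : opposite r ≢ j
    opp-r≢j e = <-irrefl (cong toℕ e) (<-trans opp-r<i (subst (toℕ i <_) (sym j≡1+i) ≤-refl))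
    no-deficit : lookup (content t) r ≡ lookup (reverse a) r
    no-deficit = begin
      lookup (content t) r   ≡⟨ cong (λ v → lookup v r) weight≡rev-β ⟩
      lookup (reverse β) r   ≡⟨ lookup-reverse′ β r ⟩
      lookup β (opposite r)  ≡⟨ β≡a-elsewhere opp-r≢i opp-r≢j ⟩
      lookup a (opposite r)  ≡⟨ sym (lookup-reverse′ a r) ⟩
      lookup (reverse a) r   ∎
      where open ≡-Reasoning

𝔏≈𝔏̂⇒noZeroAdjBig : ∀ {n} (a : Vec ℕ n) → 𝔏 a ≈P 𝔏̂ a → NoZeroAdjBig a
𝔏≈𝔏̂⇒noZeroAdjBig a eq = Equivalence.from (noZeroAdjBig⇔leftNice² a)
  (𝔏≈𝔏̂⇒leftNice a eq , 𝔏≈𝔏̂⇒leftNice (reverse a) (𝔏≈𝔏̂-reverse a eq))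

noZeroAdjBig⇒𝔏≈𝔏̂ : ∀ {n} (a : Vec ℕ n) → NoZeroAdjBig a → 𝔏 a ≈P 𝔏̂ a
noZeroAdjBig⇒𝔏≈𝔏̂ a nice α with Equivalence.to (noZeroAdjBig⇔leftNice² a) nice
... | left , right = trans (𝔏-leftNice a left α) (sym (𝔏̂-leftNice a right α))

mainTheorem15 : (n : ℕ) (P : Poly n) →
    ((∃[ b ] P ≈P 𝔏 b) × (∃[ a ] P ≈P 𝔏̂ a)) ⇔ (∃[ a ] (NoZeroAdjBig a × P ≈P 𝔏̂ a))
mainTheorem15 n P = mk⇔
  (λ ((b , P≈𝔏b) , (a , P≈𝔏̂a)) →
     let 𝔏b≈𝔏̂a : 𝔏 b ≈P 𝔏̂ a
         𝔏b≈𝔏̂a α = trans (sym (P≈𝔏b α)) (P≈𝔏̂a α)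
         𝔏a≈𝔏̂a : 𝔏 a ≈P 𝔏̂ a
         𝔏a≈𝔏̂a = subst (λ c → 𝔏 c ≈P 𝔏̂ a) (𝔏≈𝔏̂⇒≡ b a 𝔏b≈𝔏̂a) 𝔏b≈𝔏̂a
     in a , 𝔏≈𝔏̂⇒noZeroAdjBig a 𝔏a≈𝔏̂a , P≈𝔏̂a)
  (λ (a , nice , P≈𝔏̂a) →
     (a , λ α → trans (P≈𝔏̂a α) (sym (noZeroAdjBig⇒𝔏≈𝔏̂ a nice α))) , (a , P≈𝔏̂a))
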